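{- A graph $G$ is a half-square of a star biconvex bipartite graph (i.e., there is a star biconvex bipartite graph $B=(V(G),W,E_B)$ with $G=B^2[V(G)]$) if and only if $G$ has at most one big connected component and the big connected component is obtained from a split graph having a universal vertex by substituting vertices by cliques.
   Context: For a bipartite graph $B=(X,Y,E_B)$, the half-square $B^2[X]$ is the graph on $X$ where two distinct vertices are adjacent iff they have a common neighbor in $Y$. $B$ is star biconvex if there is a star $T_1$ on vertex set $X$ such that for each $y\in Y$, $N(y)$ induces a subtree of $T_1$, and there is a star $T_2$ on vertex set $Y$ such that for each $x\in X$, $N(x)$ induces a subtree of $T_2$. A connected component is big if it has at least two vertices; a universal vertex is adjacent to all other vertices of the graph. A split graph is a graph whose vertex set can be partitioned into a clique and a stable set. Substituting a vertex $v$ of $G$ by a graph $H$ yields the graph obtained from $G-v$ and $H$ by adding all edges between $N_G(v)$ and $V(H)$; "substituting vertices by cliques" means substituting some vertices, each by a nonempty complete graph. -}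

module Defs where

open import Data.Nat using (ℕ; suc)
open import Data.Fin using (Fin)
open import Data.Product using (Σ; ∃; _×_; _,_; proj₁)
open import Data.Sum using (_⊎_)
open import Data.Unit using (⊤)
open import Relation.Nullary using (¬_; Dec)
open import Relation.Binary.PropositionalEquality using (_≡_; _≢_)
open import Function.Bundles using (_⇔_)

record SimpleGraph (V : Set) : Set₁ where
  field
    Adj        : V → V → Set
    adj-dec    : ∀ u v → Dec (Adj u v)
    adj-sym    : ∀ {u v} → Adj u v → Adj v u
    adj-irrefl : ∀ {v} → ¬ Adj v v
open SimpleGraph public

record BipartiteGraph (X Y : Set) : Set₁ where
  field
    E     : X → Y → Set
    E-dec : ∀ x y → Dec (E x y)
open BipartiteGraph public

data WalkIn {V : Set} (A : V → V → Set) (S : V → Set) : V → V → Set where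
  here : ∀ {u} → S u → WalkIn A S u u
  step : ∀ {u w v} → S u → A u w → WalkIn A S w v → WalkIn A S u v

Connected : {V : Set} → SimpleGraph V → V → V → Set
Connected G u v = WalkIn (Adj G) (λ _ → ⊤) u v

IsStar : {V : Set} → SimpleGraph V → Set
IsStar {V} T = Σ V λ c → ∀ u v → Adj T u v ⇔ (u ≢ v × (u ≡ c ⊎ v ≡ c))

InducesSubtree : {V : Set} → SimpleGraph V → (V → Set) → Set
InducesSubtree {V} T S =
  (Σ V λ v → S v) × (∀ {u v} → S u → S v → WalkIn (Adj T) S u v)

StarBiconvex : {X Y : Set} → BipartiteGraph X Y → Set₁
StarBiconvex {X} {Y} B =
  (Σ (SimpleGraph X) λ T₁ → IsStar T₁ × (∀ (y : Y) → InducesSubtree T₁ (λ x → E B x y)))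
  × (Σ (SimpleGraph Y) λ T₂ → IsStar T₂ × (∀ (x : X) → InducesSubtree T₂ (λ y → E B x y)))

IsHalfSquare : {X Y : Set} → SimpleGraph X → BipartiteGraph X Y → Set
IsHalfSquare {X} {Y} G B =
  ∀ (u v : X) → Adj G u v ⇔ (u ≢ v × (Σ Y λ y → E B u y × E B v y))

BigComponentOf : {V : Set} → SimpleGraph V → V → Set
BigComponentOf {V} G v = Σ V λ w → w ≢ v × Connected G v w

AtMostOneBigComponent : {V : Set} → SimpleGraph V → Set
AtMostOneBigComponent {V} G =
  ∀ (u v : V) → BigComponentOf G u → BigComponentOf G v → Connected G u v

IsSplit : {V : Set} → SimpleGraph V → Set₁
IsSplit {V} H = Σ (V → Set) λ K →
  (∀ u v → K u → K v → u ≢ v → Adj H u v) × (∀ u v → ¬ K u → ¬ K v → ¬ Adj H u v)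

HasUniversalVertex : {V : Set} → SimpleGraph V → Set
HasUniversalVertex {V} H = Σ V λ u → ∀ v → v ≢ u → Adj H u v

-- Substituting every vertex i of H (on Fin k) by the complete graph K_{t i + 1}
-- (size 1 = vertex not substituted). Vertices: pairs (i , a) with a : Fin (suc (t i)).
SubstVertex : {k : ℕ} → (Fin k → ℕ) → Set
SubstVertex {k} t = Σ (Fin k) λ i → Fin (suc (t i))

SubstAdj : {k : ℕ} → SimpleGraph (Fin k) → (t : Fin k → ℕ) →
           SubstVertex t → SubstVertex t → Set
SubstAdj H t p q = (proj₁ p ≡ proj₁ q × p ≢ q) ⊎ Adj H (proj₁ p) (proj₁ q)

InducedIsSubstOfSplitUniversal : {V : Set} → SimpleGraph V → (V → Set) → Set₁
InducedIsSubstOfSplitUniversal {V} G C =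
  Σ ℕ λ k → Σ (SimpleGraph (Fin k)) λ H →
    IsSplit H × HasUniversalVertex H ×
    (Σ (Fin k → ℕ) λ t → Σ (SubstVertex t → V) λ φ →
        (∀ p q → φ p ≡ φ q → p ≡ q)
      × (∀ w → C w ⇔ (Σ (SubstVertex t) λ p → φ p ≡ w))
      × (∀ p q → Adj G (φ p) (φ q) ⇔ SubstAdj H t p q))

module Submission where

-- (⇒) Let c, d be the centres of the stars on X and Y.  A subtree of a star with two
-- vertices contains the centre, so every y with two neighbours sees c and every x with
-- two neighbours sees d.  Thus every edge meets N[c], the only big component.  Vertices
-- with equal B-neighbourhoods (twins) are adjacent, so N[c] is the graph H induced on
-- one representative per twin class with classes substituted by cliques; H is split
-- (clique: representatives seeing d) and the class of c is universal.
-- (⇐) Without edges take a perfect matching.  Otherwise C = N[c], c in the universal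
-- class; stable-part vertices are simplicial, so the non-simplicial vertices and the
-- closed twins of c form a clique D.  Y has a hub y₀ seeing D, a vertex seeing N[z] for
-- each closed-twin class z of C ∖ D, and vertices seeing only c or one isolated vertex;
-- the two stars are centred at c and at y₀.

open import Defs
open import Data.Nat using (ℕ; zero; suc)
open import Data.Fin using (Fin; zero; suc; Fin′; inject; fromℕ<; _<_)
open import Data.Fin.Properties
  using (all?; any?; suc-injective; toℕ-injective; toℕ-inject; toℕ-fromℕ<; <-cmp; ¬∀⟶∃¬-smallest)
  renaming (_≟_ to _≟F_)
open import Data.Product using (Σ; _×_; _,_; proj₁; proj₂; uncurry)
open import Data.Sum using (_⊎_; inj₁; inj₂)
open import Data.Unit using (tt)
open import Data.Empty using (⊥-elim)
open import Level using (0ℓ)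
open import Function.Bundles using (_⇔_; mk⇔; module Equivalence)
open import Function.Properties.Equivalence using (⇔-isEquivalence)
open import Relation.Nullary using (¬_; Dec; yes; no)
open import Relation.Nullary.Decidable
  using (_×-dec_; _⊎-dec_; _→-dec_; ¬?; map′; decidable-stable)
open import Relation.Binary.Definitions using (tri<; tri≈; tri>)
open import Relation.Binary.Structures using (IsEquivalence)
open import Relation.Binary.PropositionalEquality

open Equivalence using (to; from)
open IsEquivalence (⇔-isEquivalence {ℓ = 0ℓ})
  using () renaming (refl to ⇔-refl; sym to ⇔-sym; trans to ⇔-trans)

_⇔?_ : {A B : Set} → Dec A → Dec B → Dec (A ⇔ B)
a? ⇔? b? = map′ (uncurry mk⇔) (λ e → to e , from e) ((a? →-dec b?) ×-dec (b? →-dec a?))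

module _ {V : Set} {A : V → V → Set} {S : V → Set} where
  walk-start : ∀ {u v} → WalkIn A S u v → S u
  walk-start (here s) = s
  walk-start (step s _ _) = s

  _++ʷ_ : ∀ {u w v} → WalkIn A S u w → WalkIn A S w v → WalkIn A S u v
  here _ ++ʷ q = q
  step s a p ++ʷ q = step s a (p ++ʷ q)

module LeastRepresentatives {N : ℕ} (_~_ : Fin N → Fin N → Set) (_~?_ : ∀ x y → Dec (x ~ y))
  (~-refl : ∀ {x} → x ~ x) (~-sym : ∀ {x y} → x ~ y → y ~ x)
  (~-trans : ∀ {x y z} → x ~ y → y ~ z → x ~ z) where

  IsRep : Fin N → Set
  IsRep r = (j : Fin′ r) → ¬ (inject j ~ r)

  isRep? : ∀ r → Dec (IsRep r)
  isRep? r = all? (λ j → ¬? (inject j ~? r))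

  representative : ∀ x → Σ (Fin N) λ r → IsRep r × r ~ x
  representative x
    with ¬∀⟶∃¬-smallest N (λ i → ¬ (i ~ x)) (λ i → ¬? (i ~? x)) (λ every → every x ~-refl)
  ... | r , ¬¬r~x , smaller-≁ = r , (λ j j~r → smaller-≁ j (~-trans j~r r~x)) , r~x
    where
    r~x : r ~ x
    r~x = decidable-stable (r ~? x) ¬¬r~x

  below : ∀ {r s : Fin N} → r < s → Σ (Fin′ s) λ j → inject j ≡ r
  below r<s = fromℕ< r<s , toℕ-injective (trans (toℕ-inject (fromℕ< r<s)) (toℕ-fromℕ< r<s))

  rep-unique : ∀ {r s : Fin N} → IsRep r → IsRep s → r ~ s → r ≡ s
  rep-unique {r} {s} rep-r rep-s r~s with <-cmp r s
  ... | tri≈ _ r≡s _ = r≡s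
  ... | tri< r<s _ _ =
    let (j , j≡r) = below r<s in ⊥-elim (rep-s j (subst (_~ s) (sym j≡r) r~s))
  ... | tri> _ _ s<r =
    let (j , j≡s) = below s<r in ⊥-elim (rep-r j (subst (_~ r) (sym j≡s) (~-sym r~s)))

record Enumeration {N : ℕ} (P : Fin N → Set) (k : ℕ) : Set where
  field
    at        : Fin k → Fin N
    injective : ∀ i j → at i ≡ at j → i ≡ j
    sound     : ∀ i → P (at i)
    complete  : ∀ x → P x → Σ (Fin k) λ i → at i ≡ x

enumerate : ∀ {N} (P : Fin N → Set) → (∀ x → Dec (P x)) → Σ ℕ (Enumeration P)
enumerate {zero} P P? = 0 , record { at = λ () ; injective = λ () ; sound = λ () ; complete = λ () }
enumerate {suc N} P P? with enumerate (λ x → P (suc x)) (λ x → P? (suc x)) | P? zero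
... | k , en | no ¬P0 = k , record
  { at = λ i → suc (at i)
  ; injective = λ i j eq → injective i j (suc-injective eq)
  ; sound = sound
  ; complete = λ { zero P0 → ⊥-elim (¬P0 P0)
                 ; (suc x) Px → let (i , eq) = complete x Px in i , cong suc eq } }
  where open Enumeration en
... | k , en | yes P0 = suc k , record
  { at = at′ ; injective = injective′ ; sound = sound′
  ; complete = λ { zero _ → zero , refl
                 ; (suc x) Px → let (i , eq) = complete x Px in suc i , cong suc eq } }
  where
  open Enumeration en
  at′ : Fin (suc k) → Fin (suc N)
  at′ zero = zero
  at′ (suc i) = suc (at i)
  injective′ : ∀ i j → at′ i ≡ at′ j → i ≡ j
  injective′ zero zero _ = refl
  injective′ (suc i) (suc j) eq = cong suc (injective i j (suc-injective eq))
  sound′ : ∀ i → P (at′ i)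
  sound′ zero = P0
  sound′ (suc i) = sound i

nonempty : ∀ {N} {P : Fin N → Set} {x} → Σ ℕ (Enumeration P) → P x →
           Σ ℕ λ t → Enumeration P (suc t)
nonempty {x = x} (zero , en) Px with Enumeration.complete en x Px
... | () , _
nonempty (suc t , en) _ = t , en

module _ {V : Set} (G : SimpleGraph V) where
  adj⇒≢ : ∀ {u v} → Adj G u v → u ≢ v
  adj⇒≢ {u} uv u≡v = adj-irrefl G (subst (Adj G u) (sym u≡v) uv)

  edge-walk : ∀ {u v} → Adj G u v → Connected G u v
  edge-walk uv = step tt uv (here tt)

  edge⇒big : ∀ {u v} → Adj G u v → BigComponentOf G u
  edge⇒big {v = v} uv = v , ≢-sym (adj⇒≢ uv) , edge-walk uv

ClosedNbr : {V : Set} → SimpleGraph V → V → V → Set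
ClosedNbr G x w = w ≡ x ⊎ Adj G x w

closedNbr? : ∀ {N} (G : SimpleGraph (Fin N)) x w → Dec (ClosedNbr G x w)
closedNbr? G x w = (w ≟F x) ⊎-dec adj-dec G x w

module _ {V : Set} (G : SimpleGraph V) where
  closedNbr⇒walk : ∀ {x w} → ClosedNbr G x w → Connected G x w
  closedNbr⇒walk (inj₁ refl) = here tt
  closedNbr⇒walk (inj₂ xw) = edge-walk G xw

  closedNbr⇒walk⁻ : ∀ {x w} → ClosedNbr G x w → Connected G w x
  closedNbr⇒walk⁻ (inj₁ refl) = here tt
  closedNbr⇒walk⁻ (inj₂ xw) = edge-walk G (adj-sym G xw)

Simplicial : {V : Set} → SimpleGraph V → V → Set
Simplicial G x = ∀ a b → ClosedNbr G x a → ClosedNbr G x b → a ≢ b → Adj G a b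

simplicial? : ∀ {N} (G : SimpleGraph (Fin N)) x → Dec (Simplicial G x)
simplicial? G x = all? λ a → all? λ b →
  closedNbr? G x a →-dec (closedNbr? G x b →-dec (¬? (a ≟F b) →-dec adj-dec G a b))

-- In a split graph every vertex of the stable set is simplicial: its neighbours
-- lie in the clique.
stable⇒simplicial : ∀ {V : Set} (H : SimpleGraph V) (split : IsSplit H) →
                    ∀ {i} → ¬ proj₁ split i → Simplicial H i
stable⇒simplicial H (K , clique , stable) {i} ¬Ki a b ia ib a≢b with ia | ib
... | inj₁ refl | inj₁ refl = ⊥-elim (a≢b refl)
... | inj₁ refl | inj₂ ib′ = ib′
... | inj₂ ia′ | inj₁ refl = adj-sym H ia′
... | inj₂ ia′ | inj₂ ib′ = decidable-stable (adj-dec H a b) λ ¬ab →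
        inK ia′ λ Ka → inK ib′ λ Kb → ¬ab (clique a b Ka Kb a≢b)
  where
  inK : ∀ {j} → Adj H i j → ¬ ¬ K j
  inK {j} ij ¬Kj = stable i j ¬Ki ¬Kj ij

Twins : {V W : Set} → (V → W → Set) → V → V → Set
Twins P x x' = ∀ w → P x w ⇔ P x' w

module TwinEquivalence {V W : Set} (P : V → W → Set) where
  twin-refl : ∀ {x} → Twins P x x
  twin-refl _ = ⇔-refl

  twin-sym : ∀ {x x'} → Twins P x x' → Twins P x' x
  twin-sym t w = ⇔-sym (t w)

  twin-trans : ∀ {x x' x''} → Twins P x x' → Twins P x' x'' → Twins P x x''
  twin-trans t t' w = ⇔-trans (t w) (t' w)

twins? : ∀ {N M} (P : Fin N → Fin M → Set) → (∀ x w → Dec (P x w)) → ∀ x x' → Dec (Twins P x x')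
twins? P P? x x' = all? λ w → P? x w ⇔? P? x' w

module _ {N : ℕ} (G : SimpleGraph (Fin N)) where
  simplicial-twins : ∀ {x x'} → Simplicial G x → Simplicial G x' → Adj G x x' →
                     Twins (ClosedNbr G) x x'
  simplicial-twins sx sx' xx' w = mk⇔ (into sx xx') (into sx' (adj-sym G xx'))
    where
    into : ∀ {x x'} → Simplicial G x → Adj G x x' → ClosedNbr G x w → ClosedNbr G x' w
    into {x} {x'} sx xx' xw with w ≟F x'
    ... | yes w≡x' = inj₁ w≡x'
    ... | no w≢x' = inj₂ (sx x' w (inj₂ xx') xw (≢-sym w≢x'))

  simplicial-resp-twins : ∀ {x x'} → Twins (ClosedNbr G) x x' → Simplicial G x → Simplicial G x'
  simplicial-resp-twins t sx a b x'a x'b = sx a b (from (t a) x'a) (from (t b) x'b)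

star : ∀ {N} → Fin N → SimpleGraph (Fin N)
star c = record
  { Adj = λ u v → u ≢ v × (u ≡ c ⊎ v ≡ c)
  ; adj-dec = λ u v → ¬? (u ≟F v) ×-dec ((u ≟F c) ⊎-dec (v ≟F c))
  ; adj-sym = λ { (u≢v , inj₁ u≡c) → ≢-sym u≢v , inj₂ u≡c
                ; (u≢v , inj₂ v≡c) → ≢-sym u≢v , inj₁ v≡c }
  ; adj-irrefl = λ { (u≢u , _) → u≢u refl } }

star-isStar : ∀ {N} (c : Fin N) → IsStar (star c)
star-isStar c = c , λ u v → ⇔-refl

star-subtree : ∀ {N} (c : Fin N) (S : Fin N → Set) →
  (S c ⊎ Σ (Fin N) λ z → S z × (∀ a → S a → a ≡ z)) → InducesSubtree (star c) S
star-subtree c S (inj₁ Sc) = (c , Sc) , λ Su Sv → to-centre Su ++ʷ from-centre Sv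
  where
  to-centre : ∀ {u} → S u → WalkIn (Adj (star c)) S u c
  to-centre {u} Su with u ≟F c
  ... | yes refl = here Su
  ... | no u≢c = step Su (u≢c , inj₂ refl) (here Sc)
  from-centre : ∀ {v} → S v → WalkIn (Adj (star c)) S c v
  from-centre {v} Sv with v ≟F c
  ... | yes refl = here Sv
  ... | no v≢c = step Sc (≢-sym v≢c , inj₁ refl) (here Sv)
star-subtree c S (inj₂ (z , Sz , only-z)) = (z , Sz) , walk
  where
  walk : ∀ {u v} → S u → S v → WalkIn (Adj (star c)) S u v
  walk {u} {v} Su Sv with only-z u Su | only-z v Sv
  ... | refl | refl = here Su

walk-visits-centre : ∀ {V : Set} (T : SimpleGraph V) (s : IsStar T) {S : V → Set} {u v} →
                     WalkIn (Adj T) S u v → u ≢ v → S (proj₁ s)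
walk-visits-centre T s (here _) u≢u = ⊥-elim (u≢u refl)
walk-visits-centre T (c , is-star) (step {u} {w} Su uw p) _ with proj₂ (to (is-star u w) uw)
... | inj₁ refl = Su
... | inj₂ refl = walk-start p

StarBiconvexHalfSquare : ∀ {N} → SimpleGraph (Fin N) → Set₁
StarBiconvexHalfSquare {N} G =
  Σ ℕ λ m → Σ (BipartiteGraph (Fin N) (Fin m)) λ B → StarBiconvex B × IsHalfSquare G B

SubstitutedSplitComponent : ∀ {N} → SimpleGraph (Fin N) → Set₁
SubstitutedSplitComponent G =
  AtMostOneBigComponent G ×
  (∀ v → BigComponentOf G v → InducedIsSubstOfSplitUniversal G (Connected G v))

module HalfSquareStructure {N m : ℕ} (G : SimpleGraph (Fin N)) (B : BipartiteGraph (Fin N) (Fin m))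
  (T₁ : SimpleGraph (Fin N)) (star₁ : IsStar T₁) (sub₁ : ∀ y → InducesSubtree T₁ (λ x → E B x y))
  (T₂ : SimpleGraph (Fin m)) (star₂ : IsStar T₂) (sub₂ : ∀ x → InducesSubtree T₂ (λ y → E B x y))
  (half : IsHalfSquare G B) where

  c : Fin N
  c = proj₁ star₁

  d : Fin m
  d = proj₁ star₂

  shared⇒c : ∀ {x₁ x₂ y} → E B x₁ y → E B x₂ y → x₁ ≢ x₂ → E B c y
  shared⇒c {y = y} x₁y x₂y = walk-visits-centre T₁ star₁ (proj₂ (sub₁ y) x₁y x₂y)

  branching⇒d : ∀ {x y₁ y₂} → E B x y₁ → E B x y₂ → y₁ ≢ y₂ → E B x d
  branching⇒d {x} xy₁ xy₂ = walk-visits-centre T₂ star₂ (proj₂ (sub₂ x) xy₁ xy₂)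

  NearC : Fin N → Set
  NearC = ClosedNbr G c

  edge⇒near : ∀ {u v} → Adj G u v → NearC u
  edge⇒near {u} {v} uv with to (half u v) uv | u ≟F c
  ... | _ | yes u≡c = inj₁ u≡c
  ... | u≢v , y , uy , vy | no u≢c =
    inj₂ (from (half c u) (≢-sym u≢c , y , shared⇒c uy vy u≢v , uy))

  walk⇒near : ∀ {a x} → NearC a → Connected G a x → NearC x
  walk⇒near na (here _) = na
  walk⇒near na (step _ aw p) = walk⇒near (edge⇒near (adj-sym G aw)) p

  big⇒near : ∀ {v} → BigComponentOf G v → NearC v
  big⇒near (w , w≢v , here _) = ⊥-elim (w≢v refl)
  big⇒near (w , _ , step _ vw _) = edge⇒near vw

  oneBigComponent : AtMostOneBigComponent G
  oneBigComponent u v bu bv = closedNbr⇒walk⁻ G (big⇒near bu) ++ʷ closedNbr⇒walk G (big⇒near bv)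

  BTwin : Fin N → Fin N → Set
  BTwin = Twins (E B)

  bTwin? : ∀ x x' → Dec (BTwin x x')
  bTwin? = twins? (E B) (E-dec B)

  open TwinEquivalence (E B)

  -- Distinct B-twins are adjacent, since neighbourhoods in B are nonempty.
  twins⇒adj : ∀ {x x'} → BTwin x x' → x ≢ x' → Adj G x x'
  twins⇒adj {x} {x'} t x≢x' =
    let (y , xy) = proj₁ (sub₂ x) in from (half x x') (x≢x' , y , xy , to (t y) xy)

  adj-resp-twins : ∀ {x x' z z'} → BTwin x z → BTwin x' z' → z ≢ z' → Adj G x x' → Adj G z z'
  adj-resp-twins {x} {x'} {z} {z'} t t' z≢z' xx' =
    let (_ , y , xy , x'y) = to (half x x') xx'
    in from (half z z') (z≢z' , y , to (t y) xy , to (t' y) x'y)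

  near-resp-twins : ∀ {x x'} → NearC x → BTwin x x' → NearC x'
  near-resp-twins {x} {x'} nx t with x ≟F x'
  ... | yes refl = nx
  ... | no x≢x' = edge⇒near (adj-sym G (twins⇒adj t x≢x'))

  open LeastRepresentatives BTwin bTwin? twin-refl twin-sym twin-trans

  RepNear : Fin N → Set
  RepNear x = NearC x × IsRep x

  repEnum : Σ ℕ (Enumeration RepNear)
  repEnum = enumerate RepNear (λ x → closedNbr? G c x ×-dec isRep? x)

  k : ℕ
  k = proj₁ repEnum

  open Enumeration (proj₂ repEnum) using ()
    renaming (at to rep; injective to rep-injective; sound to rep-sound; complete to rep-complete)

  H : SimpleGraph (Fin k)
  H = record
    { Adj = λ i j → Adj G (rep i) (rep j)
    ; adj-dec = λ i j → adj-dec G (rep i) (rep j)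
    ; adj-sym = adj-sym G
    ; adj-irrefl = adj-irrefl G }

  twin-reps : ∀ i j → BTwin (rep i) (rep j) → i ≡ j
  twin-reps i j t = rep-injective i j (rep-unique (proj₂ (rep-sound i)) (proj₂ (rep-sound j)) t)

  classOf : ∀ {x} → NearC x → Σ (Fin k) λ i → BTwin (rep i) x
  classOf {x} nx with representative x
  ... | r , r-rep , r~x with rep-complete r (near-resp-twins nx (twin-sym r~x) , r-rep)
  ...   | i , rep-i≡r = i , subst (λ z → BTwin z x) (sym rep-i≡r) r~x

  unique-neighbour : ∀ {x y y'} → ¬ E B x d → E B x y → E B x y' → y' ≡ y
  unique-neighbour {y = y} {y'} ¬xd xy xy' with y' ≟F y
  ... | yes y'≡y = y'≡y
  ... | no y'≢y = ⊥-elim (¬xd (branching⇒d xy' xy y'≢y))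

  split : IsSplit H
  split = (λ i → E B (rep i) d) , clique , stable
    where
    clique : ∀ i j → E B (rep i) d → E B (rep j) d → i ≢ j → Adj H i j
    clique i j id jd i≢j = from (half (rep i) (rep j)) ((λ eq → i≢j (rep-injective i j eq)) , d , id , jd)
    -- adjacent representatives outside the clique share their only neighbour
    stable : ∀ i j → ¬ E B (rep i) d → ¬ E B (rep j) d → ¬ Adj H i j
    stable i j ¬id ¬jd ij with to (half (rep i) (rep j)) ij
    ... | rep-i≢rep-j , y , iy , jy = rep-i≢rep-j (cong rep (twin-reps i j twins))
      where
      twins : BTwin (rep i) (rep j)
      twins y' = mk⇔ (λ iy' → subst (E B (rep j)) (sym (unique-neighbour ¬id iy iy')) jy)
                     (λ jy' → subst (E B (rep i)) (sym (unique-neighbour ¬jd jy jy')) iy)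

  universal : HasUniversalVertex H
  universal = u , adj-u
    where
    u : Fin k
    u = proj₁ (classOf (inj₁ refl))
    u~c : BTwin (rep u) c
    u~c = proj₂ (classOf (inj₁ refl))
    adj-u : ∀ j → j ≢ u → Adj H u j
    adj-u j j≢u with proj₁ (rep-sound j)
    ... | inj₁ rep-j≡c =
      ⊥-elim (j≢u (twin-reps j u (subst (λ z → BTwin z (rep u)) (sym rep-j≡c) (twin-sym u~c))))
    ... | inj₂ c-rep-j =
      adj-resp-twins (twin-sym u~c) twin-refl (λ eq → j≢u (sym (rep-injective u j eq))) c-rep-j

  Class : Fin k → Fin N → Set
  Class i x = BTwin x (rep i)

  classEnum : ∀ i → Σ ℕ λ t → Enumeration (Class i) (suc t)
  classEnum i = nonempty (enumerate (Class i) (λ x → bTwin? x (rep i))) (twin-refl {x = rep i})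

  t : Fin k → ℕ
  t i = proj₁ (classEnum i)

  φ : SubstVertex t → Fin N
  φ (i , a) = Enumeration.at (proj₂ (classEnum i)) a

  φ-class : ∀ p → BTwin (φ p) (rep (proj₁ p))
  φ-class (i , a) = Enumeration.sound (proj₂ (classEnum i)) a

  φ-injective : ∀ p q → φ p ≡ φ q → p ≡ q
  φ-injective (i , a) (j , b) eq
    with twin-reps i j (twin-trans (twin-sym (φ-class (i , a)))
                                   (subst (λ z → BTwin z (rep j)) (sym eq) (φ-class (j , b))))
  ... | refl = cong (i ,_) (Enumeration.injective (proj₂ (classEnum i)) a b eq)

  φ-near : ∀ p → NearC (φ p)
  φ-near p = near-resp-twins (proj₁ (rep-sound (proj₁ p))) (twin-sym (φ-class p))

  near⇒φ : ∀ {w} → NearC w → Σ (SubstVertex t) λ p → φ p ≡ w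
  near⇒φ {w} nw with classOf nw
  ... | i , i~w = let (a , eq) = Enumeration.complete (proj₂ (classEnum i)) w (twin-sym i~w)
                  in (i , a) , eq

  φ-adj : ∀ p q → Adj G (φ p) (φ q) ⇔ SubstAdj H t p q
  φ-adj p q = mk⇔ forth back
    where
    forth : Adj G (φ p) (φ q) → SubstAdj H t p q
    forth pq with proj₁ p ≟F proj₁ q
    ... | yes same = inj₁ (same , λ p≡q → adj⇒≢ G pq (cong φ p≡q))
    ... | no diff = inj₂ (adj-resp-twins (φ-class p) (φ-class q) (λ eq → diff (rep-injective _ _ eq)) pq)
    back : SubstAdj H t p q → Adj G (φ p) (φ q)
    back (inj₁ (same , p≢q)) =
      twins⇒adj (twin-trans (φ-class p)
                            (subst (λ i → BTwin (rep i) (φ q)) (sym same) (twin-sym (φ-class q))))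
                (λ eq → p≢q (φ-injective p q eq))
    back (inj₂ ij) = adj-resp-twins (twin-sym (φ-class p)) (twin-sym (φ-class q))
                                    (λ eq → adj⇒≢ H ij (cong proj₁ (φ-injective p q eq))) ij

  bigComponentStructure : ∀ v → BigComponentOf G v → InducedIsSubstOfSplitUniversal G (Connected G v)
  bigComponentStructure v big = k , H , split , universal , t , φ , φ-injective , image , φ-adj
    where
    image : ∀ w → Connected G v w ⇔ (Σ (SubstVertex t) λ p → φ p ≡ w)
    image w = mk⇔ (λ vw → near⇒φ (walk⇒near (big⇒near big) vw))
                  (λ { (p , refl) →
                         closedNbr⇒walk⁻ G (big⇒near big) ++ʷ closedNbr⇒walk G (φ-near p) })

halfSquare⇒structure : ∀ {N} (G : SimpleGraph (Fin N)) →
                       StarBiconvexHalfSquare G → SubstitutedSplitComponent G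
halfSquare⇒structure G (_ , B , ((T₁ , star₁ , sub₁) , (T₂ , star₂ , sub₂)) , half) =
  oneBigComponent , bigComponentStructure
  where open HalfSquareStructure G B T₁ star₁ sub₁ T₂ star₂ sub₂ half

-- A graph without edges is the half-square of the perfect matching x — x, which is
-- star biconvex since all neighbourhoods are singletons.
edgeless⇒halfSquare : ∀ {n} (G : SimpleGraph (Fin (suc n))) → (∀ a b → ¬ Adj G a b) →
                      StarBiconvexHalfSquare G
edgeless⇒halfSquare {n} G no-edge = suc n , matching , starBiconvex , half
  where
  matching : BipartiteGraph (Fin (suc n)) (Fin (suc n))
  matching = record { E = _≡_ ; E-dec = _≟F_ }
  starBiconvex : StarBiconvex matching
  starBiconvex =
      (star zero , star-isStar zero ,
       λ y → star-subtree zero (_≡ y) (inj₂ (y , refl , λ _ a≡y → a≡y)))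
    , (star zero , star-isStar zero ,
       λ x → star-subtree zero (x ≡_) (inj₂ (x , refl , λ _ x≡a → sym x≡a)))
  half : IsHalfSquare G matching
  half a b = mk⇔ (λ ab → ⊥-elim (no-edge a b ab))
                 (λ { (a≢b , y , a≡y , b≡y) → ⊥-elim (a≢b (trans a≡y (sym b≡y))) })

module SubstitutedSplitHalfSquare {N : ℕ} (G : SimpleGraph (Fin N)) (oneBig : AtMostOneBigComponent G)
  (v : Fin N) (big : BigComponentOf G v)
  {k : ℕ} (H : SimpleGraph (Fin k)) (split : IsSplit H) (universal : HasUniversalVertex H)
  (t : Fin k → ℕ) (φ : SubstVertex t → Fin N) (φ-injective : ∀ p q → φ p ≡ φ q → p ≡ q)
  (image : ∀ w → Connected G v w ⇔ (Σ (SubstVertex t) λ p → φ p ≡ w))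
  (φ-adj : ∀ p q → Adj G (φ p) (φ q) ⇔ SubstAdj H t p q) where

  u : Fin k
  u = proj₁ universal

  c : Fin N
  c = φ (u , zero)

  C : Fin N → Set
  C = Connected G v

  NearC : Fin N → Set
  NearC = ClosedNbr G c

  C-φ : ∀ p → C (φ p)
  C-φ p = from (image (φ p)) (p , refl)

  C-nbr : ∀ {a b} → C a → ClosedNbr G a b → C b
  C-nbr ca ab = ca ++ʷ closedNbr⇒walk G ab

  -- C = N[c]: c, from the universal class, sees every other vertex of C.
  C⇒near : ∀ {w} → C w → NearC w
  C⇒near {w} cw with to (image w) cw
  ... | q , refl with φ q ≟F c
  ...   | yes q≡c = inj₁ q≡c
  ...   | no q≢c = inj₂ (from (φ-adj (u , zero) q) substAdj)
    where
    substAdj : SubstAdj H t (u , zero) q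
    substAdj with proj₁ q ≟F u
    ... | yes same = inj₁ (sym same , λ u≡q → q≢c (sym (cong φ u≡q)))
    ... | no diff = inj₂ (proj₂ universal (proj₁ q) diff)

  near⇒C : ∀ {w} → NearC w → C w
  near⇒C = C-nbr (C-φ (u , zero))

  edge⇒near : ∀ {a b} → Adj G a b → NearC a
  edge⇒near ab = C⇒near (oneBig v _ big (edge⇒big G ab))

  project-nbr : ∀ {p q} → ClosedNbr G (φ p) (φ q) → ClosedNbr H (proj₁ p) (proj₁ q)
  project-nbr {p} {q} (inj₁ q≡p) = inj₁ (cong proj₁ (φ-injective q p q≡p))
  project-nbr {p} {q} (inj₂ pq) with to (φ-adj p q) pq
  ... | inj₁ (same , _) = inj₁ (sym same)
  ... | inj₂ ij = inj₂ ij

  simplicial-lift : ∀ p → Simplicial H (proj₁ p) → Simplicial G (φ p)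
  simplicial-lift p simp a b pa pb a≢b
    with to (image a) (C-nbr (C-φ p) pa) | to (image b) (C-nbr (C-φ p) pb)
  ... | qa , refl | qb , refl with proj₁ qa ≟F proj₁ qb
  ...   | yes same = from (φ-adj qa qb) (inj₁ (same , λ qa≡qb → a≢b (cong φ qa≡qb)))
  ...   | no diff = from (φ-adj qa qb) (inj₂ (simp _ _ (project-nbr pa) (project-nbr pb) diff))

  K : Fin k → Set
  K = proj₁ split

  stable⇒simplicialG : ∀ p → ¬ K (proj₁ p) → Simplicial G (φ p)
  stable⇒simplicialG p ¬K = simplicial-lift p (stable⇒simplicial H split ¬K)

  -- Hence non-simplicial vertices of C come from the clique, and are pairwise adjacent.
  nonSimplicial-adj : ∀ {x x'} → ¬ Simplicial G x → ¬ Simplicial G x' →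
                      C x → C x' → x ≢ x' → Adj G x x'
  nonSimplicial-adj ¬sx ¬sx' cx cx' x≢x' with to (image _) cx | to (image _) cx'
  ... | p , refl | q , refl with proj₁ p ≟F proj₁ q
  ...   | yes same = from (φ-adj p q) (inj₁ (same , λ p≡q → x≢x' (cong φ p≡q)))
  ...   | no diff = decidable-stable (adj-dec G (φ p) (φ q)) λ ¬pq →
           ¬sx (stable⇒simplicialG p λ Kp → ¬sx' (stable⇒simplicialG q λ Kq →
             ¬pq (from (φ-adj p q) (inj₂ (proj₁ (proj₂ split) _ _ Kp Kq diff)))))

  CTwin : Fin N → Fin N → Set
  CTwin = Twins (ClosedNbr G)

  open TwinEquivalence (ClosedNbr G)

  D : Fin N → Set
  D x = NearC x × (¬ Simplicial G x ⊎ CTwin x c)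

  D? : ∀ x → Dec (D x)
  D? x = closedNbr? G c x ×-dec (¬? (simplicial? G x) ⊎-dec twins? (ClosedNbr G) (closedNbr? G) x c)

  D-c : D c
  D-c = inj₁ refl , inj₂ twin-refl

  D-clique : ∀ {x x'} → D x → D x' → x ≢ x' → Adj G x x'
  D-clique (_ , inj₂ x~c) (nx' , _) x≢x' with from (x~c _) nx'
  ... | inj₁ x'≡x = ⊥-elim (x≢x' (sym x'≡x))
  ... | inj₂ xx' = xx'
  D-clique (nx , _) (_ , inj₂ x'~c) x≢x' with from (x'~c _) nx
  ... | inj₁ x≡x' = ⊥-elim (x≢x' x≡x')
  ... | inj₂ x'x = adj-sym G x'x
  D-clique (nx , inj₁ ¬sx) (nx' , inj₁ ¬sx') x≢x' =
    nonSimplicial-adj ¬sx ¬sx' (near⇒C nx) (near⇒C nx') x≢x'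

  outsideD⇒simplicial : ∀ {z} → NearC z → ¬ D z → Simplicial G z
  outsideD⇒simplicial {z} nz ¬Dz = decidable-stable (simplicial? G z) λ ¬sz → ¬Dz (nz , inj₁ ¬sz)

  open LeastRepresentatives CTwin (twins? (ClosedNbr G) (closedNbr? G)) twin-refl twin-sym twin-trans

  ClassRep : Fin N → Set
  ClassRep z = NearC z × ¬ D z × IsRep z

  classRep? : ∀ z → Dec (ClassRep z)
  classRep? z = closedNbr? G c z ×-dec (¬? (D? z) ×-dec isRep? z)

  -- The bipartite graph, with Y = {zero} ∪ {suc z}.
  data Incident (x : Fin N) : Fin (suc N) → Set where
    inHub    : D x → Incident x zero
    inClass  : ∀ {z} → ClassRep z → ClosedNbr G z x → Incident x (suc z)
    atCentre : ∀ {z} → ¬ ClassRep z → NearC z → x ≡ c → Incident x (suc z)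
    alone    : ∀ {z} → ¬ NearC z → x ≡ z → Incident x (suc z)

  incident? : ∀ x y → Dec (Incident x y)
  incident? x zero = map′ inHub (λ { (inHub Dx) → Dx }) (D? x)
  incident? x (suc z) with classRep? z | closedNbr? G c z
  ... | yes rz | _ = map′ (inClass rz)
    (λ { (inClass _ zx) → zx
       ; (atCentre ¬rz _ _) → ⊥-elim (¬rz rz)
       ; (alone ¬nz _) → ⊥-elim (¬nz (proj₁ rz)) })
    (closedNbr? G z x)
  ... | no ¬rz | yes nz = map′ (atCentre ¬rz nz)
    (λ { (inClass rz _) → ⊥-elim (¬rz rz)
       ; (atCentre _ _ x≡c) → x≡c
       ; (alone ¬nz _) → ⊥-elim (¬nz nz) })
    (x ≟F c)
  ... | no ¬rz | no ¬nz = map′ (alone ¬nz)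
    (λ { (inClass rz _) → ⊥-elim (¬rz rz)
       ; (atCentre _ nz _) → ⊥-elim (¬nz nz)
       ; (alone _ x≡z) → x≡z })
    (x ≟F z)

  B : BipartiteGraph (Fin N) (Fin (suc N))
  B = record { E = Incident ; E-dec = incident? }

  module OutsideD {x} (nx : NearC x) (¬Dx : ¬ D x) where
    r : Fin N
    r = proj₁ (representative x)

    r~x : CTwin r x
    r~x = proj₂ (proj₂ (representative x))

    r-near : NearC r
    r-near with from (r~x x) (inj₁ refl)
    ... | inj₁ x≡r = subst NearC x≡r nx
    ... | inj₂ rx = edge⇒near rx

    r-classRep : ClassRep r
    r-classRep = r-near , ¬Dr , proj₁ (proj₂ (representative x))
      where
      ¬Dr : ¬ D r
      ¬Dr (_ , inj₁ ¬sr) = ¬Dx (nx , inj₁ λ sx → ¬sr (simplicial-resp-twins G (twin-sym r~x) sx))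
      ¬Dr (_ , inj₂ r~c) = ¬Dx (nx , inj₂ (twin-trans (twin-sym r~x) r~c))

    nbr-incident : ∀ {w} → ClosedNbr G x w → Incident w (suc r)
    nbr-incident {w} xw = inClass r-classRep (from (r~x w) xw)

    incident-unique : ∀ y → Incident x y → y ≡ suc r
    incident-unique zero (inHub Dx) = ⊥-elim (¬Dx Dx)
    incident-unique (suc z) (inClass rz zx) =
      cong suc (rep-unique (proj₂ (proj₂ rz)) (proj₂ (proj₂ r-classRep))
                           (twin-trans (z~x zx) (twin-sym r~x)))
      where
      -- x ∈ N[z] with both simplicial makes z and x closed twins
      z~x : ClosedNbr G z x → CTwin z x
      z~x (inj₁ refl) = twin-refl
      z~x (inj₂ zx′) = simplicial-twins G (outsideD⇒simplicial (proj₁ rz) (proj₁ (proj₂ rz)))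
                                         (outsideD⇒simplicial nx ¬Dx) zx′
    incident-unique (suc z) (atCentre _ _ x≡c) = ⊥-elim (¬Dx (subst D (sym x≡c) D-c))
    incident-unique (suc z) (alone ¬nz x≡z) = ⊥-elim (¬nz (subst NearC x≡z nx))

  -- Each y sees c, or exactly one vertex: star condition for T₁ centred at c.
  centred₁ : ∀ y → Incident c y ⊎ Σ (Fin N) λ z → Incident z y × (∀ a → Incident a y → a ≡ z)
  centred₁ zero = inj₁ (inHub D-c)
  centred₁ (suc z) with classRep? z | closedNbr? G c z
  ... | yes rz | _ = inj₁ (inClass rz z-c)
    where
    z-c : ClosedNbr G z c
    z-c with proj₁ rz
    ... | inj₁ z≡c = ⊥-elim (proj₁ (proj₂ rz) (subst D (sym z≡c) D-c))
    ... | inj₂ cz = inj₂ (adj-sym G cz)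
  ... | no ¬rz | yes nz = inj₁ (atCentre ¬rz nz refl)
  ... | no ¬rz | no ¬nz = inj₂ (z , alone ¬nz refl , only-z)
    where
    only-z : ∀ a → Incident a (suc z) → a ≡ z
    only-z a (inClass rz _) = ⊥-elim (¬rz rz)
    only-z a (atCentre _ nz _) = ⊥-elim (¬nz nz)
    only-z a (alone _ a≡z) = a≡z

  -- Each x sees zero, or exactly one y: star condition for T₂ centred at zero.
  centred₂ : ∀ x → Incident x zero ⊎
                   Σ (Fin (suc N)) λ y → Incident x y × (∀ y' → Incident x y' → y' ≡ y)
  centred₂ x with D? x | closedNbr? G c x
  ... | yes Dx | _ = inj₁ (inHub Dx)
  ... | no ¬Dx | yes nx = inj₂ (suc r , nbr-incident (inj₁ refl) , incident-unique)
    where open OutsideD nx ¬Dx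
  ... | no ¬Dx | no ¬nx = inj₂ (suc x , alone ¬nx refl , only-suc-x)
    where
    only-suc-x : ∀ y' → Incident x y' → y' ≡ suc x
    only-suc-x zero (inHub Dx) = ⊥-elim (¬Dx Dx)
    only-suc-x (suc z) (inClass _ (inj₁ x≡z)) = cong suc (sym x≡z)
    only-suc-x (suc z) (inClass _ (inj₂ zx)) = ⊥-elim (¬nx (edge⇒near (adj-sym G zx)))
    only-suc-x (suc z) (atCentre _ _ x≡c) = ⊥-elim (¬nx (inj₁ x≡c))
    only-suc-x (suc z) (alone _ x≡z) = cong suc (sym x≡z)

  starBiconvex : StarBiconvex B
  starBiconvex = (star c , star-isStar c , λ y → star-subtree c (λ x → Incident x y) (centred₁ y))
               , (star zero , star-isStar zero , λ x → star-subtree zero (Incident x) (centred₂ x))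

  common⇒adj : ∀ {a b} → a ≢ b → ∀ y → Incident a y → Incident b y → Adj G a b
  common⇒adj a≢b zero (inHub Da) (inHub Db) = D-clique Da Db a≢b
  common⇒adj a≢b (suc z) (inClass rz za) (inClass _ zb) =
    outsideD⇒simplicial (proj₁ rz) (proj₁ (proj₂ rz)) _ _ za zb a≢b
  common⇒adj a≢b (suc z) (inClass rz _) (atCentre ¬rz _ _) = ⊥-elim (¬rz rz)
  common⇒adj a≢b (suc z) (inClass rz _) (alone ¬nz _) = ⊥-elim (¬nz (proj₁ rz))
  common⇒adj a≢b (suc z) (atCentre ¬rz _ _) (inClass rz _) = ⊥-elim (¬rz rz)
  common⇒adj a≢b (suc z) (atCentre _ _ a≡c) (atCentre _ _ b≡c) = ⊥-elim (a≢b (trans a≡c (sym b≡c)))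
  common⇒adj a≢b (suc z) (atCentre _ nz _) (alone ¬nz _) = ⊥-elim (¬nz nz)
  common⇒adj a≢b (suc z) (alone ¬nz _) (inClass rz _) = ⊥-elim (¬nz (proj₁ rz))
  common⇒adj a≢b (suc z) (alone ¬nz _) (atCentre _ nz _) = ⊥-elim (¬nz nz)
  common⇒adj a≢b (suc z) (alone _ a≡z) (alone _ b≡z) = ⊥-elim (a≢b (trans a≡z (sym b≡z)))

  -- Conversely every edge ab has a common y: zero if both lie in D, otherwise
  -- the class vertex of an endpoint outside D.
  adj⇒common : ∀ {a b} → Adj G a b → Σ (Fin (suc N)) λ y → Incident a y × Incident b y
  adj⇒common {a} {b} ab with D? a | D? b
  ... | yes Da | yes Db = zero , inHub Da , inHub Db
  ... | yes _ | no ¬Db = suc r , nbr-incident (inj₂ (adj-sym G ab)) , nbr-incident (inj₁ refl)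
    where open OutsideD (edge⇒near (adj-sym G ab)) ¬Db
  ... | no ¬Da | _ = suc r , nbr-incident (inj₁ refl) , nbr-incident (inj₂ ab)
    where open OutsideD (edge⇒near ab) ¬Da

  halfSquare : IsHalfSquare G B
  halfSquare a b = mk⇔ (λ ab → adj⇒≢ G ab , adj⇒common ab)
                       (λ { (a≢b , y , ay , by) → common⇒adj a≢b y ay by })

structure⇒halfSquare : ∀ {n} (G : SimpleGraph (Fin (suc n))) → SubstitutedSplitComponent G →
                       StarBiconvexHalfSquare G
structure⇒halfSquare G (oneBig , structure) with any? (λ a → any? (λ b → adj-dec G a b))
... | no no-edge = edgeless⇒halfSquare G λ a b ab → no-edge (a , b , ab)
... | yes (a , b , ab) with structure a (edge⇒big G ab)
...   | _ , H , split , universal , t , φ , φ-injective , image , φ-adj = _ , B , starBiconvex , halfSquare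
  where
  open SubstitutedSplitHalfSquare G oneBig a (edge⇒big G ab) H split universal
                                  t φ φ-injective image φ-adj

theorem3 : (n : ℕ) (G : SimpleGraph (Fin (suc n))) →
    (Σ ℕ λ m → Σ (BipartiteGraph (Fin (suc n)) (Fin m)) λ B →
        StarBiconvex B × IsHalfSquare G B)
    ⇔ (AtMostOneBigComponent G ×
        (∀ v → BigComponentOf G v → InducedIsSubstOfSplitUniversal G (Connected G v)))
theorem3 n G = mk⇔ (halfSquare⇒structure G) (structure⇒halfSquare G)
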